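{- Let $G$ be a finite simple graph of clique-width $cw$, and let $G\bar{G}$ denote its complementary prism. Then $G\bar{G}$ has clique-width at most $4cw$.
   Context: For a graph $G$ with vertex set $V(G)=\{v_1,\ldots,v_n\}$, the complementary prism $G\bar{G}$ is the graph with vertex set $\{v_1,\ldots,v_n\}\cup\{\bar{v}_1,\ldots,\bar{v}_n\}$ and edge set $E(G)\cup\{\bar{v}_i\bar{v}_j: 1\le i<j\le n,\ v_iv_j\notin E(G)\}\cup\{v_1\bar{v}_1,\ldots,v_n\bar{v}_n\}$; that is, it is the disjoint union of $G$ and its complement $\bar{G}$ together with a perfect matching joining each $v_i$ to its copy $\bar{v}_i$. Clique-width is the standard graph parameter. -}

module Defs where

open import Data.Nat using (ℕ; _+_; _<_)
open import Data.Fin using (Fin; splitAt)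
open import Data.Fin.Properties using (_≟_)
open import Data.Fin.Permutation using (Permutation′; _⟨$⟩ʳ_)
open import Data.Bool using (Bool; true; false; _∧_; _∨_; not)
open import Data.Sum using (_⊎_; inj₁; inj₂)
open import Data.Product using (Σ; _×_; _,_)
open import Relation.Nullary using (¬_)
open import Relation.Nullary.Decidable using (⌊_⌋)
open import Relation.Binary.PropositionalEquality using (_≡_; _≢_; refl; cong₂; sym)
open import Relation.Nullary using (yes; no)
open import Data.Bool.Properties using (∧-zeroʳ)

record Graph (n : ℕ) : Set where
  field
    adj     : Fin n → Fin n → Bool
    adj-sym : ∀ u v → adj u v ≡ adj v u
    adj-irr : ∀ u → adj u u ≡ false
open Graph public

_==_ : ∀ {n} → Fin n → Fin n → Bool
u == v = ⌊ u ≟ v ⌋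

-- k-expressions (Courcelle–Olariu), indexed by the number of vertices
-- of the labelled graph they produce.  Labels are Fin k.

data Expr (k : ℕ) : ℕ → Set where
  vert    : Fin k → Expr k 1
  union   : ∀ {m n} → Expr k m → Expr k n → Expr k (m + n)
  join    : ∀ {n} (i j : Fin k) → i ≢ j → Expr k n → Expr k n
  relabel : ∀ {n} (i j : Fin k) → Expr k n → Expr k n

label : ∀ {k n} → Expr k n → Fin n → Fin k
label (vert i) _ = i
label (union {m} e f) v with splitAt m v
... | inj₁ a = label e a
... | inj₂ b = label f b
label (join i j _ e) v = label e v
label (relabel i j e) v with label e v == i
... | true  = j
... | false = label e v

edge : ∀ {k n} → Expr k n → Fin n → Fin n → Bool
edge (vert i) _ _ = false
edge (union {m} e f) u v with splitAt m u | splitAt m v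
... | inj₁ a | inj₁ b = edge e a b
... | inj₂ a | inj₂ b = edge f a b
... | inj₁ _ | inj₂ _ = false
... | inj₂ _ | inj₁ _ = false
edge (join i j _ e) u v =
  edge e u v
  ∨ (label e u == i ∧ label e v == j)
  ∨ (label e u == j ∧ label e v == i)
edge (relabel i j e) u v = edge e u v

Defines : ∀ {k n} → Expr k n → Graph n → Set
Defines {n = n} e G =
  Σ (Permutation′ n) λ π → ∀ u v → edge e (π ⟨$⟩ʳ u) (π ⟨$⟩ʳ v) ≡ adj G u v

CWAtMost : ∀ {n} → ℕ → Graph n → Set
CWAtMost {n} k G = Σ (Expr k n) λ e → Defines e G

CliqueWidth : ∀ {n} → Graph n → ℕ → Set
CliqueWidth G c = CWAtMost c G × (∀ k → k < c → ¬ CWAtMost k G)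

-- Complementary prism G Ḡ on Fin (n + n): the first copy is G
-- (vertex v_i ↦ inj₁ i), the second copy is the complement Ḡ
-- (v̄_i ↦ inj₂ i), plus the perfect matching v_i v̄_i.

prismAdj : ∀ {n} → Graph n → Fin (n + n) → Fin (n + n) → Bool
prismAdj {n} G x y with splitAt n x | splitAt n y
... | inj₁ u | inj₁ v = adj G u v
... | inj₂ u | inj₂ v = not (adj G u v) ∧ not (u == v)
... | inj₁ u | inj₂ v = u == v
... | inj₂ u | inj₁ v = u == v

private
  ==-sym : ∀ {n} (u v : Fin n) → (u == v) ≡ (v == u)
  ==-sym u v with u ≟ v | v ≟ u
  ... | yes _ | yes _ = refl
  ... | no _  | no _  = refl
  ... | yes p | no q  = Data.Empty.⊥-elim (q (sym p))
    where import Data.Empty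
  ... | no p  | yes q = Data.Empty.⊥-elim (p (sym q))
    where import Data.Empty

  ==-refl : ∀ {n} (u : Fin n) → (u == u) ≡ true
  ==-refl u with u ≟ u
  ... | yes _ = refl
  ... | no p  = Data.Empty.⊥-elim (p refl)
    where import Data.Empty

  prism-sym : ∀ {n} (G : Graph n) x y → prismAdj G x y ≡ prismAdj G y x
  prism-sym {n} G x y with splitAt n x | splitAt n y
  ... | inj₁ u | inj₁ v = adj-sym G u v
  ... | inj₂ u | inj₂ v = cong₂ (λ a b → not a ∧ not b) (adj-sym G u v) (==-sym u v)
  ... | inj₁ u | inj₂ v = ==-sym u v
  ... | inj₂ u | inj₁ v = ==-sym u v

  prism-irr : ∀ {n} (G : Graph n) x → prismAdj G x x ≡ false
  prism-irr {n} G x with splitAt n x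
  ... | inj₁ u = adj-irr G u
  ... | inj₂ u rewrite ==-refl u = ∧-zeroʳ (not (adj G u u))

prism : ∀ {n} → Graph n → Graph (n + n)
prism G = record { adj = prismAdj G ; adj-sym = prism-sym G ; adj-irr = prism-irr G }

module Submission where

-- From a k-expression for G we build, by recursion on it, a 3k-expression for the complementary prism G Ḡ.
-- Each label x comes in three tagged copies: x_orig for the vertices of G, x_compl for those of Ḡ, and
-- x_parked, used only inside a union. A vertex i(v) becomes i_orig(v) ⊕ i_compl(v̄) joined by the matching
-- edge; η_{a,b} acts on the orig copies and ρ_{a→b} on both. The edges of Ḡ are created at the unions,
-- between the two operands: vertices on different sides become adjacent in G iff an enclosing η joins their
-- labels, so once the compl labels of the left operand are parked, every parked x is joined to every compl y
-- such that no enclosing η joins x and y. These label pairs are passed down the recursion as a context.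
-- The construction gives cw(G Ḡ) ≤ 3 cw(G).

open import Defs
open import Data.Nat using (ℕ; zero; suc; _+_; _*_; _≤_)
open import Data.Nat.Properties using (*-monoˡ-≤; n≤1+n)
open import Data.Fin using (Fin; zero; suc; splitAt; combine; inject≤; _↑ˡ_; _↑ʳ_)
open import Data.Fin.Properties
  using (_≟_; +↔⊎; combine-injectiveˡ; combine-injectiveʳ; inject≤-injective; suc-injective
        ; splitAt-↑ˡ; splitAt-↑ʳ; join-splitAt; ↑ˡ-injective; ↑ʳ-injective)
open import Data.Fin.Permutation using (Permutation; _⟨$⟩ʳ_; ↔⇒≡)
open import Data.Bool using (Bool; true; false; _∧_; _∨_; not; if_then_else_)
open import Data.Bool.Properties
  using (∨-assoc; ∨-comm; ∨-identityʳ; ∧-comm; ∧-identityʳ; ∧-zeroʳ; if-float)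
open import Data.Sum using (_⊎_; inj₁; inj₂; [_,_])
import Data.Sum as Sum
open import Data.Sum.Function.Propositional using (_⊎-↔_)
open import Data.Product using (_,_)
open import Function using (_∘_; Injective)
open import Function.Bundles using (_↔_; mk↔ₛ′; Inverse; Injection)
open import Function.Construct.Composition using (_↔-∘_)
open import Function.Construct.Symmetry using (↔-sym)
open import Function.Properties.Inverse using (↔⇒↣)
open import Relation.Nullary using (yes; no)
open import Relation.Nullary.Decidable using (dec-true; dec-false; isYes≗does)
open import Relation.Binary.PropositionalEquality
  using (_≡_; _≢_; refl; sym; trans; cong; cong₂; module ≡-Reasoning)

open ≡-Reasoning

==-refl : ∀ {n} (u : Fin n) → (u == u) ≡ true
==-refl u = trans (isYes≗does (u ≟ u)) (dec-true (u ≟ u) refl)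

==-false : ∀ {n} {u v : Fin n} → u ≢ v → (u == v) ≡ false
==-false {u = u} {v} u≢v = trans (isYes≗does (u ≟ v)) (dec-false (u ≟ v) u≢v)

==-injective : ∀ {m n} {f : Fin m → Fin n} → Injective _≡_ _≡_ f → ∀ u v → (f u == f v) ≡ (u == v)
==-injective {f = f} f-inj u v with u ≟ v
... | yes refl = ==-refl (f u)
... | no u≢v   = ==-false (u≢v ∘ f-inj)

∨-falseʳ : ∀ {a b} → b ≡ false → a ∨ b ≡ a
∨-falseʳ {a} refl = ∨-identityʳ a

anyFin : ∀ {n} → (Fin n → Bool) → Bool
anyFin {zero}  f = false
anyFin {suc n} f = anyFin (f ∘ suc) ∨ f zero

anyFin-cong : ∀ {n} {f g : Fin n → Bool} → (∀ x → f x ≡ g x) → anyFin f ≡ anyFin g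
anyFin-cong {zero}  f≗g = refl
anyFin-cong {suc n} f≗g = cong₂ _∨_ (anyFin-cong (f≗g ∘ suc)) (f≗g zero)

anyFin-false : ∀ {n} {f : Fin n → Bool} → (∀ x → f x ≡ false) → anyFin f ≡ false
anyFin-false {zero}  f≗false = refl
anyFin-false {suc n} f≗false = cong₂ _∨_ (anyFin-false (f≗false ∘ suc)) (f≗false zero)

anyFin-only : ∀ {n} {f : Fin n → Bool} a → (∀ x → x ≢ a → f x ≡ false) → anyFin f ≡ f a
anyFin-only {f = f} zero    off = cong (_∨ f zero) (anyFin-false λ x → off (suc x) λ ())
anyFin-only {f = f} (suc a) off = begin
  anyFin (f ∘ suc) ∨ f zero
    ≡⟨ cong₂ _∨_ (anyFin-only a λ x x≢a → off (suc x) (x≢a ∘ suc-injective)) (off zero λ ()) ⟩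
  f (suc a) ∨ false
    ≡⟨ ∨-identityʳ _ ⟩
  f (suc a) ∎

anyFin²-pick : ∀ {r r'} (f : Fin r → Fin r' → Bool) a b →
               anyFin (λ x → anyFin λ y → f x y ∧ ((a == x) ∧ (b == y))) ≡ f a b
anyFin²-pick f a b = begin
  anyFin (λ x → anyFin λ y → f x y ∧ ((a == x) ∧ (b == y)))
    ≡⟨ anyFin-only a (λ x x≢a → anyFin-false (row-off x x≢a)) ⟩
  anyFin (λ y → f a y ∧ ((a == a) ∧ (b == y)))
    ≡⟨ anyFin-only b column-off ⟩
  f a b ∧ ((a == a) ∧ (b == b))
    ≡⟨ cong₂ (λ c c' → f a b ∧ (c ∧ c')) (==-refl a) (==-refl b) ⟩
  f a b ∧ true
    ≡⟨ ∧-identityʳ _ ⟩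
  f a b ∎
  where
  row-off : ∀ x → x ≢ a → ∀ y → f x y ∧ ((a == x) ∧ (b == y)) ≡ false
  row-off x x≢a y rewrite ==-false {u = a} {x} (x≢a ∘ sym) = ∧-zeroʳ (f x y)

  column-off : ∀ y → y ≢ b → f a y ∧ ((a == a) ∧ (b == y)) ≡ false
  column-off y y≢b rewrite ==-false {u = b} {y} (y≢b ∘ sym) | ∧-zeroʳ (a == a) = ∧-zeroʳ (f a y)

connects : ∀ {K} → Fin K → Fin K → Fin K → Fin K → Bool
connects i j l l' = (l == i ∧ l' == j) ∨ (l == j ∧ l' == i)

connects-sym : ∀ {K} (i j l l' : Fin K) → connects i j l l' ≡ connects i j l' l
connects-sym i j l l' = begin
  (l == i ∧ l' == j) ∨ (l == j ∧ l' == i) ≡⟨ cong₂ _∨_ (∧-comm (l == i) _) (∧-comm (l == j) _) ⟩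
  (l' == j ∧ l == i) ∨ (l' == i ∧ l == j) ≡⟨ ∨-comm (l' == j ∧ l == i) _ ⟩
  (l' == i ∧ l == j) ∨ (l' == j ∧ l == i) ∎

connects-hit : ∀ {K} (i j : Fin K) → connects i j i j ≡ true
connects-hit i j rewrite ==-refl i | ==-refl j = refl

connects-false : ∀ {K} {i j l l' : Fin K} → l ≢ i ⊎ l' ≢ j → l ≢ j ⊎ l' ≢ i →
                 connects i j l l' ≡ false
connects-false {i = i} {j} {l} {l'} (inj₁ l≢i) (inj₁ l≢j)
  rewrite ==-false l≢i | ==-false l≢j = refl
connects-false {i = i} {j} {l} {l'} (inj₁ l≢i) (inj₂ l'≢i)
  rewrite ==-false l≢i | ==-false l'≢i = ∧-zeroʳ (l == j)
connects-false {i = i} {j} {l} {l'} (inj₂ l'≢j) (inj₁ l≢j)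
  rewrite ==-false l'≢j | ==-false l≢j = trans (∨-identityʳ _) (∧-zeroʳ (l == i))
connects-false {i = i} {j} {l} {l'} (inj₂ l'≢j) (inj₂ l'≢i)
  rewrite ==-false l'≢j | ==-false l'≢i | ∧-zeroʳ (l == i) = ∧-zeroʳ (l == j)

rename : ∀ {K} → Fin K → Fin K → Fin K → Fin K
rename i j l = if l == i then j else l

rename-hit : ∀ {K} (i j : Fin K) → rename i j i ≡ j
rename-hit i j rewrite ==-refl i = refl

rename-miss : ∀ {K} {i l : Fin K} (j : Fin K) → l ≢ i → rename i j l ≡ l
rename-miss j l≢i rewrite ==-false l≢i = refl

label-relabel : ∀ {K n} (i j : Fin K) (e : Expr K n) v → label (relabel i j e) v ≡ rename i j (label e v)
label-relabel i j e v with label e v == i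
... | true  = refl
... | false = refl

module _ {K K'} {ι : Fin K → Fin K'} (ι-inj : Injective _≡_ _≡_ ι) where

  connects-injective : ∀ i j l l' → connects (ι i) (ι j) (ι l) (ι l') ≡ connects i j l l'
  connects-injective i j l l'
    rewrite ==-injective ι-inj l i | ==-injective ι-inj l j
          | ==-injective ι-inj l' i | ==-injective ι-inj l' j = refl

  rename-injective : ∀ i j l → rename (ι i) (ι j) (ι l) ≡ ι (rename i j l)
  rename-injective i j l = begin
    (if ι l == ι i then ι j else ι l) ≡⟨ cong (if_then ι j else ι l) (==-injective ι-inj l i) ⟩
    (if l == i then ι j else ι l)     ≡⟨ if-float ι (l == i) ⟨
    ι (rename i j l)                  ∎

renameAll : ∀ {K r} → (Fin r → Fin K) → (Fin r → Fin K) → Fin K → Fin K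
renameAll {r = zero}  s t l = l
renameAll {r = suc r} s t l = rename (s zero) (t zero) (renameAll (s ∘ suc) (t ∘ suc) l)

renameAll-miss : ∀ {K r} (s t : Fin r → Fin K) {l} → (∀ x → l ≢ s x) → renameAll s t l ≡ l
renameAll-miss {r = zero}  s t l∉s = refl
renameAll-miss {r = suc r} s t {l} l∉s = begin
  rename (s zero) (t zero) (renameAll (s ∘ suc) (t ∘ suc) l)
    ≡⟨ cong (rename (s zero) (t zero)) (renameAll-miss (s ∘ suc) (t ∘ suc) {l} (l∉s ∘ suc)) ⟩
  rename (s zero) (t zero) l
    ≡⟨ rename-miss (t zero) (l∉s zero) ⟩
  l ∎

renameAll-hit : ∀ {K r} (s t : Fin r → Fin K) → Injective _≡_ _≡_ s → (∀ x y → t x ≢ s y) →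
                ∀ a → renameAll s t (s a) ≡ t a
renameAll-hit {r = suc r} s t s-inj t∉s zero = begin
  rename (s zero) (t zero) (renameAll (s ∘ suc) (t ∘ suc) (s zero))
    ≡⟨ cong (rename (s zero) (t zero))
            (renameAll-miss (s ∘ suc) (t ∘ suc) λ x → (λ ()) ∘ s-inj {zero} {suc x}) ⟩
  rename (s zero) (t zero) (s zero)
    ≡⟨ rename-hit (s zero) (t zero) ⟩
  t zero ∎
renameAll-hit {r = suc r} s t s-inj t∉s (suc a) = begin
  rename (s zero) (t zero) (renameAll (s ∘ suc) (t ∘ suc) (s (suc a)))
    ≡⟨ cong (rename (s zero) (t zero))
            (renameAll-hit (s ∘ suc) (t ∘ suc) (suc-injective ∘ s-inj) (λ x y → t∉s (suc x) (suc y)) a) ⟩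
  rename (s zero) (t zero) (t (suc a))
    ≡⟨ rename-miss (t zero) (t∉s (suc a) zero) ⟩
  t (suc a) ∎

module _ {K N : ℕ} where

  relabelAll : ∀ {r} → (Fin r → Fin K) → (Fin r → Fin K) → Expr K N → Expr K N
  relabelAll {zero}  s t E = E
  relabelAll {suc r} s t E = relabel (s zero) (t zero) (relabelAll (s ∘ suc) (t ∘ suc) E)

  label-relabelAll : ∀ {r} (s t : Fin r → Fin K) E w → label (relabelAll s t E) w ≡ renameAll s t (label E w)
  label-relabelAll {zero}  s t E w = refl
  label-relabelAll {suc r} s t E w = begin
    label (relabel (s zero) (t zero) E′) w
      ≡⟨ label-relabel (s zero) (t zero) E′ w ⟩
    rename (s zero) (t zero) (label E′ w)
      ≡⟨ cong (rename (s zero) (t zero)) (label-relabelAll (s ∘ suc) (t ∘ suc) E w) ⟩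
    rename (s zero) (t zero) (renameAll (s ∘ suc) (t ∘ suc) (label E w)) ∎
    where E′ = relabelAll (s ∘ suc) (t ∘ suc) E

  edge-relabelAll : ∀ {r} (s t : Fin r → Fin K) E u v → edge (relabelAll s t E) u v ≡ edge E u v
  edge-relabelAll {zero}  s t E u v = refl
  edge-relabelAll {suc r} s t E u v = edge-relabelAll (s ∘ suc) (t ∘ suc) E u v

  joinWhen : Bool → (i j : Fin K) → i ≢ j → Expr K N → Expr K N
  joinWhen true  i j i≢j E = join i j i≢j E
  joinWhen false i j i≢j E = E

  label-joinWhen : ∀ b i j i≢j E w → label (joinWhen b i j i≢j E) w ≡ label E w
  label-joinWhen true  i j i≢j E w = refl
  label-joinWhen false i j i≢j E w = refl

  edge-joinWhen : ∀ b i j i≢j E u v →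
                  edge (joinWhen b i j i≢j E) u v ≡ edge E u v ∨ (b ∧ connects i j (label E u) (label E v))
  edge-joinWhen true  i j i≢j E u v = refl
  edge-joinWhen false i j i≢j E u v = sym (∨-identityʳ _)

  joinRow : ∀ {r} (p : Fin r → Bool) i (t : Fin r → Fin K) → (∀ y → i ≢ t y) → Expr K N → Expr K N
  joinRow {zero}  p i t i∉t E = E
  joinRow {suc r} p i t i∉t E =
    joinWhen (p zero) i (t zero) (i∉t zero) (joinRow (p ∘ suc) i (t ∘ suc) (i∉t ∘ suc) E)

  label-joinRow : ∀ {r} p i (t : Fin r → Fin K) i∉t E w → label (joinRow p i t i∉t E) w ≡ label E w
  label-joinRow {zero}  p i t i∉t E w = refl
  label-joinRow {suc r} p i t i∉t E w =
    trans (label-joinWhen (p zero) i (t zero) (i∉t zero) (joinRow (p ∘ suc) i (t ∘ suc) (i∉t ∘ suc) E) w)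
          (label-joinRow (p ∘ suc) i (t ∘ suc) (i∉t ∘ suc) E w)

  edge-joinRow : ∀ {r} p i (t : Fin r → Fin K) i∉t E u v →
                 edge (joinRow p i t i∉t E) u v
                   ≡ edge E u v ∨ anyFin (λ y → p y ∧ connects i (t y) (label E u) (label E v))
  edge-joinRow {zero}  p i t i∉t E u v = sym (∨-identityʳ _)
  edge-joinRow {suc r} p i t i∉t E u v
    rewrite edge-joinWhen (p zero) i (t zero) (i∉t zero) (joinRow (p ∘ suc) i (t ∘ suc) (i∉t ∘ suc) E) u v
          | label-joinRow (p ∘ suc) i (t ∘ suc) (i∉t ∘ suc) E u
          | label-joinRow (p ∘ suc) i (t ∘ suc) (i∉t ∘ suc) E v
          | edge-joinRow (p ∘ suc) i (t ∘ suc) (i∉t ∘ suc) E u v = ∨-assoc (edge E u v) _ _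

  joinEach : ∀ {r r'} (p : Fin r → Fin r' → Bool) (s : Fin r → Fin K) (t : Fin r' → Fin K) →
             (∀ x y → s x ≢ t y) → Expr K N → Expr K N
  joinEach {zero}  p s t s∉t E = E
  joinEach {suc r} p s t s∉t E =
    joinRow (p zero) (s zero) t (s∉t zero) (joinEach (p ∘ suc) (s ∘ suc) t (s∉t ∘ suc) E)

  label-joinEach : ∀ {r r'} p (s : Fin r → Fin K) (t : Fin r' → Fin K) s∉t E w →
                   label (joinEach p s t s∉t E) w ≡ label E w
  label-joinEach {zero}  p s t s∉t E w = refl
  label-joinEach {suc r} p s t s∉t E w =
    trans (label-joinRow (p zero) (s zero) t (s∉t zero) (joinEach (p ∘ suc) (s ∘ suc) t (s∉t ∘ suc) E) w)
          (label-joinEach (p ∘ suc) (s ∘ suc) t (s∉t ∘ suc) E w)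

crossEdges : ∀ {K r r'} → (Fin r → Fin r' → Bool) → (Fin r → Fin K) → (Fin r' → Fin K) →
             Fin K → Fin K → Bool
crossEdges p s t l l' = anyFin λ x → anyFin λ y → p x y ∧ connects (s x) (t y) l l'

edge-joinEach : ∀ {K N r r'} p (s : Fin r → Fin K) (t : Fin r' → Fin K) s∉t (E : Expr K N) u v →
                edge (joinEach p s t s∉t E) u v ≡ edge E u v ∨ crossEdges p s t (label E u) (label E v)
edge-joinEach {r = zero}  p s t s∉t E u v = sym (∨-identityʳ _)
edge-joinEach {r = suc r} p s t s∉t E u v
  rewrite edge-joinRow (p zero) (s zero) t (s∉t zero) (joinEach (p ∘ suc) (s ∘ suc) t (s∉t ∘ suc) E) u v
        | label-joinEach (p ∘ suc) (s ∘ suc) t (s∉t ∘ suc) E u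
        | label-joinEach (p ∘ suc) (s ∘ suc) t (s∉t ∘ suc) E v
        | edge-joinEach (p ∘ suc) (s ∘ suc) t (s∉t ∘ suc) E u v = ∨-assoc (edge E u v) _ _

module _ {K r r' : ℕ} (p : Fin r → Fin r' → Bool) (s : Fin r → Fin K) (t : Fin r' → Fin K) where

  crossEdges-sym : ∀ l l' → crossEdges p s t l l' ≡ crossEdges p s t l' l
  crossEdges-sym l l' = anyFin-cong λ x → anyFin-cong λ y → cong (p x y ∧_) (connects-sym (s x) (t y) l l')

  crossEdges-false : ∀ l l' → (∀ x y → l ≢ s x ⊎ l' ≢ t y) → (∀ x y → l ≢ t y ⊎ l' ≢ s x) →
                     crossEdges p s t l l' ≡ false
  crossEdges-false l l' h h' = anyFin-false λ x → anyFin-false λ y →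
    trans (cong (p x y ∧_) (connects-false (h x y) (h' x y))) (∧-zeroʳ _)

  crossEdges-hit : Injective _≡_ _≡_ s → Injective _≡_ _≡_ t → (∀ x y → s x ≢ t y) →
                   ∀ a b → crossEdges p s t (s a) (t b) ≡ p a b
  crossEdges-hit s-inj t-inj s∉t a b =
    trans (anyFin-cong λ x → anyFin-cong λ y → cong (p x y ∧_) (connects-images x y)) (anyFin²-pick p a b)
    where
    connects-images : ∀ x y → connects (s x) (t y) (s a) (t b) ≡ (a == x) ∧ (b == y)
    connects-images x y
      rewrite ==-injective s-inj a x | ==-injective t-inj b y | ==-false (s∉t a y) = ∨-identityʳ _

-- Clique-width is monotone in the number of labels

module _ {k k' : ℕ} {ι : Fin k → Fin k'} (ι-inj : Injective _≡_ _≡_ ι) where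

  mapLabels : ∀ {n} → Expr k n → Expr k' n
  mapLabels (vert i)         = vert (ι i)
  mapLabels (union e f)      = union (mapLabels e) (mapLabels f)
  mapLabels (join i j i≢j e) = join (ι i) (ι j) (i≢j ∘ ι-inj) (mapLabels e)
  mapLabels (relabel i j e)  = relabel (ι i) (ι j) (mapLabels e)

  label-mapLabels : ∀ {n} (e : Expr k n) v → label (mapLabels e) v ≡ ι (label e v)
  label-mapLabels (vert i) v = refl
  label-mapLabels (union {m} e f) v with splitAt m v
  ... | inj₁ a = label-mapLabels e a
  ... | inj₂ b = label-mapLabels f b
  label-mapLabels (join i j i≢j e) v = label-mapLabels e v
  label-mapLabels (relabel i j e) v = begin
    label (relabel (ι i) (ι j) (mapLabels e)) v ≡⟨ label-relabel (ι i) (ι j) (mapLabels e) v ⟩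
    rename (ι i) (ι j) (label (mapLabels e) v)  ≡⟨ cong (rename (ι i) (ι j)) (label-mapLabels e v) ⟩
    rename (ι i) (ι j) (ι (label e v))          ≡⟨ rename-injective ι-inj i j (label e v) ⟩
    ι (rename i j (label e v))                  ≡⟨ cong ι (label-relabel i j e v) ⟨
    ι (label (relabel i j e) v)                 ∎

  edge-mapLabels : ∀ {n} (e : Expr k n) u v → edge (mapLabels e) u v ≡ edge e u v
  edge-mapLabels (vert i) u v = refl
  edge-mapLabels (union {m} e f) u v with splitAt m u | splitAt m v
  ... | inj₁ a | inj₁ b = edge-mapLabels e a b
  ... | inj₂ a | inj₂ b = edge-mapLabels f a b
  ... | inj₁ a | inj₂ b = refl
  ... | inj₂ a | inj₁ b = refl
  edge-mapLabels (join i j i≢j e) u v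
    rewrite edge-mapLabels e u v | label-mapLabels e u | label-mapLabels e v =
    cong (edge e u v ∨_) (connects-injective ι-inj i j (label e u) (label e v))
  edge-mapLabels (relabel i j e) u v = edge-mapLabels e u v

CWAtMost-≤ : ∀ {k k' n} {G : Graph n} → k ≤ k' → CWAtMost k G → CWAtMost k' G
CWAtMost-≤ k≤k' (e , π , e-defines-G) = mapLabels ι-inj e , π , λ u v →
  trans (edge-mapLabels ι-inj e (π ⟨$⟩ʳ u) (π ⟨$⟩ʳ v)) (e-defines-G u v)
  where
  ι-inj : Injective _≡_ _≡_ (λ i → inject≤ i k≤k')
  ι-inj = inject≤-injective k≤k' k≤k' _ _

CWAtMost-via : ∀ {K N n} {G : Graph n} (E : Expr K N) (π : Permutation n N) →
               (∀ u v → edge E (π ⟨$⟩ʳ u) (π ⟨$⟩ʳ v) ≡ adj G u v) → CWAtMost K G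
CWAtMost-via E π E-defines-G with refl ← ↔⇒≡ π = E , π , E-defines-G

unionVertex↔ : ∀ m p → ((Fin m ⊎ Fin m) ⊎ (Fin p ⊎ Fin p)) ↔ (Fin (m + p) ⊎ Fin (m + p))
unionVertex↔ m p = mk↔ₛ′ to from to∘from from∘to
  where
  to : (Fin m ⊎ Fin m) ⊎ (Fin p ⊎ Fin p) → Fin (m + p) ⊎ Fin (m + p)
  to = [ Sum.map (_↑ˡ p) (_↑ˡ p) , Sum.map (m ↑ʳ_) (m ↑ʳ_) ]

  from : Fin (m + p) ⊎ Fin (m + p) → (Fin m ⊎ Fin m) ⊎ (Fin p ⊎ Fin p)
  from (inj₁ u) = Sum.map inj₁ inj₁ (splitAt m u)
  from (inj₂ u) = Sum.map inj₂ inj₂ (splitAt m u)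

  to∘from : ∀ x → to (from x) ≡ x
  to∘from (inj₁ u) with splitAt m u | join-splitAt m p u
  ... | inj₁ _ | eq = cong inj₁ eq
  ... | inj₂ _ | eq = cong inj₁ eq
  to∘from (inj₂ u) with splitAt m u | join-splitAt m p u
  ... | inj₁ _ | eq = cong inj₂ eq
  ... | inj₂ _ | eq = cong inj₂ eq

  from∘to : ∀ y → from (to y) ≡ y
  from∘to (inj₁ (inj₁ u)) rewrite splitAt-↑ˡ m u p = refl
  from∘to (inj₁ (inj₂ u)) rewrite splitAt-↑ˡ m u p = refl
  from∘to (inj₂ (inj₁ u)) rewrite splitAt-↑ʳ m p u = refl
  from∘to (inj₂ (inj₂ u)) rewrite splitAt-↑ʳ m p u = refl

↑ˡ≢↑ʳ : ∀ {m p} (u : Fin m) (v : Fin p) → u ↑ˡ p ≢ m ↑ʳ v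
↑ˡ≢↑ʳ {m} {p} u v eq
  with () ← trans (sym (splitAt-↑ˡ m u p)) (trans (cong (splitAt m) eq) (splitAt-↑ʳ m p v))

record Embedding {k m m'} (f : Expr k m) (f' : Expr k m') : Set where
  field
    ι         : Fin m → Fin m'
    injective : Injective _≡_ _≡_ ι
    edge-ι    : ∀ u v → edge f' (ι u) (ι v) ≡ edge f u v
    label-ι   : ∀ u → label f' (ι u) ≡ label f u

module _ {k m p : ℕ} (f : Expr k m) (g : Expr k p) where

  unionˡ-embedding : Embedding f (union f g)
  unionˡ-embedding = record
    { ι = _↑ˡ p ; injective = ↑ˡ-injective p _ _ ; edge-ι = edge-↑ˡ ; label-ι = label-↑ˡ }
    where
    edge-↑ˡ : ∀ u v → edge (union f g) (u ↑ˡ p) (v ↑ˡ p) ≡ edge f u v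
    edge-↑ˡ u v rewrite splitAt-↑ˡ m u p | splitAt-↑ˡ m v p = refl

    label-↑ˡ : ∀ u → label (union f g) (u ↑ˡ p) ≡ label f u
    label-↑ˡ u rewrite splitAt-↑ˡ m u p = refl

  unionʳ-embedding : Embedding g (union f g)
  unionʳ-embedding = record
    { ι = m ↑ʳ_ ; injective = ↑ʳ-injective m _ _ ; edge-ι = edge-↑ʳ ; label-ι = label-↑ʳ }
    where
    edge-↑ʳ : ∀ u v → edge (union f g) (m ↑ʳ u) (m ↑ʳ v) ≡ edge g u v
    edge-↑ʳ u v rewrite splitAt-↑ʳ m p u | splitAt-↑ʳ m p v = refl

    label-↑ʳ : ∀ u → label (union f g) (m ↑ʳ u) ≡ label g u
    label-↑ʳ u rewrite splitAt-↑ʳ m p u = refl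

  edge-union-↑ˡ↑ʳ : ∀ u v → edge (union f g) (u ↑ˡ p) (m ↑ʳ v) ≡ false
  edge-union-↑ˡ↑ʳ u v rewrite splitAt-↑ˡ m u p | splitAt-↑ʳ m p v = refl

  edge-union-↑ʳ↑ˡ : ∀ u v → edge (union f g) (m ↑ʳ u) (v ↑ˡ p) ≡ false
  edge-union-↑ʳ↑ˡ u v rewrite splitAt-↑ʳ m p u | splitAt-↑ˡ m v p = refl

-- The labelled complementary prism of a k-expression

module Prism {k : ℕ} where

  -- C x y: an enclosing η joins the images of x and y under the enclosing relabellings.
  Context : Set
  Context = Fin k → Fin k → Bool

  related : Context → Fin k → Fin k → Bool
  related C x y = C x y ∨ C y x

  noContext : Context
  noContext _ _ = false

  orig compl parked : Fin 3
  orig   = zero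
  compl  = suc zero
  parked = suc (suc zero)

  -- Opaque, so that a tag and a base label can be inferred from a tagged label.
  opaque
    tagged : Fin 3 → Fin k → Fin (3 * k)
    tagged = combine

    tagged-injective : ∀ t → Injective _≡_ _≡_ (tagged t)
    tagged-injective t {a} {b} = combine-injectiveʳ t a t b

    tagged-≢ : ∀ {t t' a b} → t ≢ t' → tagged t a ≢ tagged t' b
    tagged-≢ t≢t' = t≢t' ∘ combine-injectiveˡ _ _ _ _

  renameAll-tagged : ∀ {t t'} → t ≢ t' → ∀ s a →
                     renameAll (tagged t) (tagged t') (tagged s a) ≡ tagged (rename t t' s) a
  renameAll-tagged {t} {t'} t≢t' s a with s ≟ t
  ... | yes refl = renameAll-hit (tagged t) (tagged t') (tagged-injective t) (λ _ _ → tagged-≢ (t≢t' ∘ sym)) a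
  ... | no s≢t   = renameAll-miss (tagged t) (tagged t') (λ _ → tagged-≢ s≢t)

  -- The vertices inj₁ u form the copy of f, the vertices inj₂ u its complement copy.
  prismLabel : ∀ {m} → Fin 3 → Expr k m → Fin m ⊎ Fin m → Fin (3 * k)
  prismLabel t f = [ tagged orig ∘ label f , tagged t ∘ label f ]

  prismEdge : ∀ {m} → Expr k m → Context → Fin m ⊎ Fin m → Fin m ⊎ Fin m → Bool
  prismEdge f C (inj₁ u) (inj₁ v) = edge f u v
  prismEdge f C (inj₁ u) (inj₂ v) = u == v
  prismEdge f C (inj₂ u) (inj₁ v) = u == v
  prismEdge f C (inj₂ u) (inj₂ v) = not (edge f u v) ∧ not (related C (label f u) (label f v)) ∧ not (u == v)

  record Realises {m N} (f : Expr k m) (C : Context) (E : Expr (3 * k) N) (φ : Fin N → Fin m ⊎ Fin m) : Set where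
    field
      edge-≡  : ∀ w w' → edge E w w' ≡ prismEdge f C (φ w) (φ w')
      label-≡ : ∀ w → label E w ≡ prismLabel compl f (φ w)
  open Realises

  prismLabel-≢ : ∀ {m t t'} (f : Expr k m) → orig ≢ t' → t ≢ t' →
                 ∀ X y → prismLabel t f X ≢ tagged t' y
  prismLabel-≢ f o≢t' t≢t' (inj₁ u) y = tagged-≢ o≢t'
  prismLabel-≢ f o≢t' t≢t' (inj₂ u) y = tagged-≢ t≢t'

  renameAll-prismLabel : ∀ {m t t'} → t ≢ t' → orig ≢ t → ∀ s (f : Expr k m) X →
                         renameAll (tagged t) (tagged t') (prismLabel s f X) ≡ prismLabel (rename t t' s) f X
  renameAll-prismLabel {t' = t'} t≢t' o≢t s f (inj₁ u) =
    trans (renameAll-tagged t≢t' orig (label f u)) (cong (λ o → tagged o (label f u)) (rename-miss t' o≢t))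
  renameAll-prismLabel t≢t' o≢t s f (inj₂ u) = renameAll-tagged t≢t' s (label f u)

  module _ {m m'} {f : Expr k m} {f' : Expr k m'} (ε : Embedding f f') where
    open Embedding ε

    prismLabel-embed : ∀ t X → prismLabel t f' (Sum.map ι ι X) ≡ prismLabel t f X
    prismLabel-embed t (inj₁ u) = cong (tagged orig) (label-ι u)
    prismLabel-embed t (inj₂ u) = cong (tagged t) (label-ι u)

    prismEdge-embed : ∀ C X Y → prismEdge f' C (Sum.map ι ι X) (Sum.map ι ι Y) ≡ prismEdge f C X Y
    prismEdge-embed C (inj₁ u) (inj₁ v) = edge-ι u v
    prismEdge-embed C (inj₁ u) (inj₂ v) = ==-injective injective u v
    prismEdge-embed C (inj₂ u) (inj₁ v) = ==-injective injective u v
    prismEdge-embed C (inj₂ u) (inj₂ v)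
      rewrite edge-ι u v | label-ι u | label-ι v | ==-injective injective u v = refl

  vertStep : Fin k → Expr (3 * k) 2
  vertStep i = join (tagged orig i) (tagged compl i) (tagged-≢ λ ())
                    (union (vert (tagged orig i)) (vert (tagged compl i)))

  vert-realises : ∀ i C → Realises (vert i) C (vertStep i) (splitAt 1)
  vert-realises i C = record { edge-≡ = edges ; label-≡ = labels }
    where
    o≢c : tagged orig i ≢ tagged compl i
    o≢c = tagged-≢ λ ()

    labels : ∀ w → label (vertStep i) w ≡ prismLabel compl (vert i) (splitAt 1 w)
    labels zero       = refl
    labels (suc zero) = refl

    edges : ∀ w w' → edge (vertStep i) w w' ≡ prismEdge (vert i) C (splitAt 1 w) (splitAt 1 w')
    edges zero       zero       = connects-false (inj₂ o≢c) (inj₁ o≢c)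
    edges zero       (suc zero) = connects-hit (tagged orig i) (tagged compl i)
    edges (suc zero) zero       =
      trans (connects-sym _ _ (tagged compl i) (tagged orig i)) (connects-hit (tagged orig i) (tagged compl i))
    edges (suc zero) (suc zero) =
      trans (connects-false (inj₁ (o≢c ∘ sym)) (inj₂ (o≢c ∘ sym))) (sym (∧-zeroʳ (not (related C i i))))

  joinContext : Fin k → Fin k → Context → Context
  joinContext a b C x y = C x y ∨ connects a b x y

  joinStep : ∀ {N} (a b : Fin k) → a ≢ b → Expr (3 * k) N → Expr (3 * k) N
  joinStep a b a≢b E = join (tagged orig a) (tagged orig b) (a≢b ∘ tagged-injective orig) E

  join-realises : ∀ {m N} {f : Expr k m} {C E} {φ : Fin N → Fin m ⊎ Fin m} a b (a≢b : a ≢ b) →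
                  Realises f (joinContext a b C) E φ → Realises (join a b a≢b f) C (joinStep a b a≢b E) φ
  join-realises {f = f} {C} {E} {φ} a b a≢b r = record { edge-≡ = edges ; label-≡ = label-≡ r }
    where
    ηₒ : Fin (3 * k) → Fin (3 * k) → Bool
    ηₒ = connects (tagged orig a) (tagged orig b)

    c≢o : ∀ x y → tagged compl x ≢ tagged orig y
    c≢o x y = tagged-≢ λ ()

    nonEdge-into-context : ∀ e j c c' n →
                           not e ∧ not ((c ∨ j) ∨ (c' ∨ j)) ∧ n ≡ not (e ∨ j) ∧ not (c ∨ c') ∧ n
    nonEdge-into-context true  j     c     c'    n = refl
    nonEdge-into-context false true  true  c'    n = refl
    nonEdge-into-context false true  false c'    n = refl
    nonEdge-into-context false false true  c'    n = refl
    nonEdge-into-context false false false true  n = refl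
    nonEdge-into-context false false false false n = refl

    join-prismEdge : ∀ X Y → prismEdge f (joinContext a b C) X Y
                               ∨ ηₒ (prismLabel compl f X) (prismLabel compl f Y)
                           ≡ prismEdge (join a b a≢b f) C X Y
    join-prismEdge (inj₁ u) (inj₁ v) =
      cong (edge f u v ∨_) (connects-injective (tagged-injective orig) a b (label f u) (label f v))
    join-prismEdge (inj₁ u) (inj₂ v) =
      ∨-falseʳ (connects-false {l = tagged orig (label f u)}
                                (inj₂ (c≢o (label f v) b)) (inj₂ (c≢o (label f v) a)))
    join-prismEdge (inj₂ u) (inj₁ v) =
      ∨-falseʳ (connects-false {l' = tagged orig (label f v)}
                                (inj₁ (c≢o (label f u) a)) (inj₁ (c≢o (label f u) b)))
    join-prismEdge (inj₂ u) (inj₂ v) = begin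
      (not e ∧ not ((C lu lv ∨ η) ∨ (C lv lu ∨ connects a b lv lu)) ∧ n)
        ∨ ηₒ (tagged compl lu) (tagged compl lv)
        ≡⟨ cong₂ (λ j c → (not e ∧ not ((C lu lv ∨ η) ∨ (C lv lu ∨ j)) ∧ n) ∨ c)
                 (connects-sym a b lv lu)
                 (connects-false {l' = tagged compl lv} (inj₁ (c≢o lu a)) (inj₁ (c≢o lu b))) ⟩
      (not e ∧ not ((C lu lv ∨ η) ∨ (C lv lu ∨ η)) ∧ n) ∨ false
        ≡⟨ ∨-identityʳ _ ⟩
      not e ∧ not ((C lu lv ∨ η) ∨ (C lv lu ∨ η)) ∧ n
        ≡⟨ nonEdge-into-context e η (C lu lv) (C lv lu) n ⟩
      not (e ∨ η) ∧ not (C lu lv ∨ C lv lu) ∧ n ∎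
      where
      e = edge f u v
      lu = label f u
      lv = label f v
      η = connects a b lu lv
      n = not (u == v)

    edges : ∀ w w' → edge (joinStep a b a≢b E) w w' ≡ prismEdge (join a b a≢b f) C (φ w) (φ w')
    edges w w' = begin
      edge E w w' ∨ ηₒ (label E w) (label E w')
        ≡⟨ cong₂ _∨_ (edge-≡ r w w') (cong₂ ηₒ (label-≡ r w) (label-≡ r w')) ⟩
      prismEdge f (joinContext a b C) (φ w) (φ w') ∨ ηₒ (prismLabel compl f (φ w)) (prismLabel compl f (φ w'))
        ≡⟨ join-prismEdge (φ w) (φ w') ⟩
      prismEdge (join a b a≢b f) C (φ w) (φ w') ∎

  relabelContext : Fin k → Fin k → Context → Context
  relabelContext a b C x y = C (rename a b x) (rename a b y)

  relabelStep : ∀ {N} → Fin k → Fin k → Expr (3 * k) N → Expr (3 * k) N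
  relabelStep a b E = relabel (tagged orig a) (tagged orig b) (relabel (tagged compl a) (tagged compl b) E)

  relabel-realises : ∀ {m N} {f : Expr k m} {C E} {φ : Fin N → Fin m ⊎ Fin m} a b →
                     Realises f (relabelContext a b C) E φ → Realises (relabel a b f) C (relabelStep a b E) φ
  relabel-realises {f = f} {C} {E} {φ} a b r = record { edge-≡ = edges ; label-≡ = labels }
    where
    ρₒ ρ꜀ : Fin (3 * k) → Fin (3 * k)
    ρₒ = rename (tagged orig a) (tagged orig b)
    ρ꜀ = rename (tagged compl a) (tagged compl b)

    relabel-prismLabel : ∀ X → ρₒ (ρ꜀ (prismLabel compl f X)) ≡ prismLabel compl (relabel a b f) X
    relabel-prismLabel (inj₁ u) = begin
      ρₒ (ρ꜀ (tagged orig (label f u)))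
        ≡⟨ cong ρₒ (rename-miss (tagged compl b) (tagged-≢ λ ())) ⟩
      ρₒ (tagged orig (label f u))
        ≡⟨ rename-injective (tagged-injective orig) a b (label f u) ⟩
      tagged orig (rename a b (label f u))
        ≡⟨ cong (tagged orig) (label-relabel a b f u) ⟨
      tagged orig (label (relabel a b f) u) ∎
    relabel-prismLabel (inj₂ u) = begin
      ρₒ (ρ꜀ (tagged compl (label f u)))
        ≡⟨ cong ρₒ (rename-injective (tagged-injective compl) a b (label f u)) ⟩
      ρₒ (tagged compl (rename a b (label f u)))
        ≡⟨ rename-miss (tagged orig b) (tagged-≢ λ ()) ⟩
      tagged compl (rename a b (label f u))
        ≡⟨ cong (tagged compl) (label-relabel a b f u) ⟨
      tagged compl (label (relabel a b f) u) ∎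

    labels : ∀ w → label (relabelStep a b E) w ≡ prismLabel compl (relabel a b f) (φ w)
    labels w = begin
      label (relabelStep a b E) w
        ≡⟨ label-relabel (tagged orig a) (tagged orig b) (relabel (tagged compl a) (tagged compl b) E) w ⟩
      ρₒ (label (relabel (tagged compl a) (tagged compl b) E) w)
        ≡⟨ cong ρₒ (label-relabel (tagged compl a) (tagged compl b) E w) ⟩
      ρₒ (ρ꜀ (label E w))
        ≡⟨ cong (ρₒ ∘ ρ꜀) (label-≡ r w) ⟩
      ρₒ (ρ꜀ (prismLabel compl f (φ w)))
        ≡⟨ relabel-prismLabel (φ w) ⟩
      prismLabel compl (relabel a b f) (φ w) ∎

    relabel-prismEdge : ∀ X Y → prismEdge f (relabelContext a b C) X Y ≡ prismEdge (relabel a b f) C X Y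
    relabel-prismEdge (inj₁ u) (inj₁ v) = refl
    relabel-prismEdge (inj₁ u) (inj₂ v) = refl
    relabel-prismEdge (inj₂ u) (inj₁ v) = refl
    relabel-prismEdge (inj₂ u) (inj₂ v) rewrite label-relabel a b f u | label-relabel a b f v = refl

    edges : ∀ w w' → edge (relabelStep a b E) w w' ≡ prismEdge (relabel a b f) C (φ w) (φ w')
    edges w w' = trans (edge-≡ r w w') (relabel-prismEdge (φ w) (φ w'))

  nonAdjacent : Context → Fin k → Fin k → Bool
  nonAdjacent C x y = not (related C x y)

  parked≢compl : ∀ x y → tagged parked x ≢ tagged compl y
  parked≢compl x y = tagged-≢ λ ()

  park unpark : ∀ {N} → Expr (3 * k) N → Expr (3 * k) N
  park   = relabelAll (tagged compl) (tagged parked)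
  unpark = relabelAll (tagged parked) (tagged compl)

  -- Parking the complement labels of the left operand keeps the joins from adding edges inside either operand.
  unionStep : ∀ {Nf Ng} → Context → Expr (3 * k) Nf → Expr (3 * k) Ng → Expr (3 * k) (Nf + Ng)
  unionStep C Ef Eg =
    unpark (joinEach (nonAdjacent C) (tagged parked) (tagged compl) parked≢compl (union (park Ef) Eg))

  unionVertex : ∀ {m p} → (Fin m ⊎ Fin m) ⊎ (Fin p ⊎ Fin p) → Fin (m + p) ⊎ Fin (m + p)
  unionVertex {m} {p} = Inverse.to (unionVertex↔ m p)

  union-realises : ∀ {m p Nf Ng} {f : Expr k m} {g : Expr k p} {C Ef Eg}
                     {φf : Fin Nf → Fin m ⊎ Fin m} {φg : Fin Ng → Fin p ⊎ Fin p} →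
                   Realises f C Ef φf → Realises g C Eg φg →
                   Realises (union f g) C (unionStep C Ef Eg) (unionVertex ∘ Sum.map φf φg ∘ splitAt Nf)
  union-realises {m} {p} {Nf} {Ng} {f} {g} {C} {Ef} {Eg} {φf} {φg} rf rg =
    record { edge-≡ = edges ; label-≡ = labels }
    where
    E₀ = union (park Ef) Eg
    E₁ = joinEach (nonAdjacent C) (tagged parked) (tagged compl) parked≢compl E₀
    φ = unionVertex ∘ Sum.map φf φg ∘ splitAt Nf

    cross : Fin (3 * k) → Fin (3 * k) → Bool
    cross = crossEdges (nonAdjacent C) (tagged parked) (tagged compl)

    cross-hit : ∀ x y → cross (tagged parked x) (tagged compl y) ≡ nonAdjacent C x y
    cross-hit = crossEdges-hit (nonAdjacent C) (tagged parked) (tagged compl)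
                  (tagged-injective parked) (tagged-injective compl) parked≢compl

    cross-false : ∀ s s' a b → s ≢ parked ⊎ s' ≢ compl → s ≢ compl ⊎ s' ≢ parked →
                  cross (tagged s a) (tagged s' b) ≡ false
    cross-false s s' a b h h' =
      crossEdges-false (nonAdjacent C) (tagged parked) (tagged compl) (tagged s a) (tagged s' b)
        (λ _ _ → Sum.map tagged-≢ tagged-≢ h) (λ _ _ → Sum.map tagged-≢ tagged-≢ h')

    cross-∉compl : ∀ l l' → (∀ y → l ≢ tagged compl y) → (∀ y → l' ≢ tagged compl y) →
                   cross l l' ≡ false
    cross-∉compl l l' l∉c l'∉c = crossEdges-false (nonAdjacent C) (tagged parked) (tagged compl) l l'
                                   (λ _ y → inj₂ (l'∉c y)) (λ _ y → inj₁ (l∉c y))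

    cross-∉parked : ∀ l l' → (∀ x → l ≢ tagged parked x) → (∀ x → l' ≢ tagged parked x) →
                    cross l l' ≡ false
    cross-∉parked l l' l∉p l'∉p = crossEdges-false (nonAdjacent C) (tagged parked) (tagged compl) l l'
                                    (λ x _ → inj₁ (l∉p x)) (λ x _ → inj₂ (l'∉p x))

    side : Fin Nf ⊎ Fin Ng → Fin (3 * k)
    side = [ prismLabel parked f ∘ φf , prismLabel compl g ∘ φg ]

    labels₀ : ∀ w → label E₀ w ≡ side (splitAt Nf w)
    labels₀ w with splitAt Nf w
    ... | inj₁ a = begin
      label (park Ef) a
        ≡⟨ label-relabelAll (tagged compl) (tagged parked) Ef a ⟩
      renameAll (tagged compl) (tagged parked) (label Ef a)
        ≡⟨ cong (renameAll (tagged compl) (tagged parked)) (label-≡ rf a) ⟩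
      renameAll (tagged compl) (tagged parked) (prismLabel compl f (φf a))
        ≡⟨ renameAll-prismLabel (λ ()) (λ ()) compl f (φf a) ⟩
      prismLabel parked f (φf a) ∎
    ... | inj₂ b = label-≡ rg b

    unpark-side : ∀ z → renameAll (tagged parked) (tagged compl) (side z)
                          ≡ prismLabel compl (union f g) (unionVertex (Sum.map φf φg z))
    unpark-side (inj₁ a) = trans (renameAll-prismLabel (λ ()) (λ ()) parked f (φf a))
                                 (sym (prismLabel-embed (unionˡ-embedding f g) compl (φf a)))
    unpark-side (inj₂ b) = trans (renameAll-prismLabel (λ ()) (λ ()) compl g (φg b))
                                 (sym (prismLabel-embed (unionʳ-embedding f g) compl (φg b)))

    labels : ∀ w → label (unionStep C Ef Eg) w ≡ prismLabel compl (union f g) (φ w)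
    labels w = begin
      label (unpark E₁) w
        ≡⟨ label-relabelAll (tagged parked) (tagged compl) E₁ w ⟩
      renameAll (tagged parked) (tagged compl) (label E₁ w)
        ≡⟨ cong (renameAll (tagged parked) (tagged compl))
                (trans (label-joinEach (nonAdjacent C) (tagged parked) (tagged compl) parked≢compl E₀ w)
                       (labels₀ w)) ⟩
      renameAll (tagged parked) (tagged compl) (side (splitAt Nf w))
        ≡⟨ unpark-side (splitAt Nf w) ⟩
      prismLabel compl (union f g) (φ w) ∎

    cross-fg : ∀ X Y → cross (prismLabel parked f X) (prismLabel compl g Y)
                         ≡ prismEdge (union f g) C (unionVertex {m} {p} (inj₁ X)) (unionVertex {m} {p} (inj₂ Y))
    cross-fg (inj₁ u) (inj₁ v) =
      trans (cross-false orig orig (label f u) (label g v) (inj₁ λ ()) (inj₁ λ ()))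
            (sym (edge-union-↑ˡ↑ʳ f g u v))
    cross-fg (inj₁ u) (inj₂ v) =
      trans (cross-false orig compl (label f u) (label g v) (inj₁ λ ()) (inj₁ λ ()))
            (sym (==-false (↑ˡ≢↑ʳ u v)))
    cross-fg (inj₂ u) (inj₁ v) =
      trans (cross-false parked orig (label f u) (label g v) (inj₂ λ ()) (inj₂ λ ()))
            (sym (==-false (↑ˡ≢↑ʳ u v)))
    cross-fg (inj₂ u) (inj₂ v)
      rewrite edge-union-↑ˡ↑ʳ f g u v | ==-false (↑ˡ≢↑ʳ u v)
            | Embedding.label-ι (unionˡ-embedding f g) u | Embedding.label-ι (unionʳ-embedding f g) v =
      trans (cross-hit (label f u) (label g v)) (sym (∧-identityʳ _))

    cross-gf : ∀ X Y → cross (prismLabel compl g X) (prismLabel parked f Y)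
                         ≡ prismEdge (union f g) C (unionVertex {m} {p} (inj₂ X)) (unionVertex {m} {p} (inj₁ Y))
    cross-gf (inj₁ u) (inj₁ v) =
      trans (cross-false orig orig (label g u) (label f v) (inj₁ λ ()) (inj₁ λ ()))
            (sym (edge-union-↑ʳ↑ˡ f g u v))
    cross-gf (inj₁ u) (inj₂ v) =
      trans (cross-false orig parked (label g u) (label f v) (inj₁ λ ()) (inj₁ λ ()))
            (sym (==-false (↑ˡ≢↑ʳ v u ∘ sym)))
    cross-gf (inj₂ u) (inj₁ v) =
      trans (cross-false compl orig (label g u) (label f v) (inj₂ λ ()) (inj₂ λ ()))
            (sym (==-false (↑ˡ≢↑ʳ v u ∘ sym)))
    cross-gf (inj₂ u) (inj₂ v)
      rewrite edge-union-↑ʳ↑ˡ f g u v | ==-false (↑ˡ≢↑ʳ v u ∘ sym)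
            | Embedding.label-ι (unionʳ-embedding f g) u | Embedding.label-ι (unionˡ-embedding f g) v = begin
      cross (tagged compl lu) (tagged parked lv)
        ≡⟨ crossEdges-sym (nonAdjacent C) (tagged parked) (tagged compl) (tagged compl lu) (tagged parked lv) ⟩
      cross (tagged parked lv) (tagged compl lu) ≡⟨ cross-hit lv lu ⟩
      not (related C lv lu)                      ≡⟨ cong not (∨-comm (C lv lu) _) ⟩
      not (related C lu lv)                      ≡⟨ ∧-identityʳ _ ⟨
      not (related C lu lv) ∧ true               ∎
      where
      lu = label g u
      lv = label f v

    edges₀ : ∀ w w' → edge E₀ w w' ∨ cross (side (splitAt Nf w)) (side (splitAt Nf w'))
                        ≡ prismEdge (union f g) C (φ w) (φ w')
    edges₀ w w' with splitAt Nf w | splitAt Nf w'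
    ... | inj₁ a | inj₁ b = begin
      edge (park Ef) a b ∨ cross (prismLabel parked f X) (prismLabel parked f Y)
        ≡⟨ ∨-falseʳ (cross-∉compl _ _ (prismLabel-≢ f (λ ()) (λ ()) X)
                                      (prismLabel-≢ f (λ ()) (λ ()) Y)) ⟩
      edge (park Ef) a b ≡⟨ edge-relabelAll (tagged compl) (tagged parked) Ef a b ⟩
      edge Ef a b        ≡⟨ edge-≡ rf a b ⟩
      prismEdge f C X Y  ≡⟨ prismEdge-embed (unionˡ-embedding f g) C X Y ⟨
      prismEdge (union f g) C (unionVertex {m} {p} (inj₁ X)) (unionVertex {m} {p} (inj₁ Y)) ∎
      where
      X = φf a
      Y = φf b
    ... | inj₂ a | inj₂ b = begin
      edge Eg a b ∨ cross (prismLabel compl g X) (prismLabel compl g Y)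
        ≡⟨ ∨-falseʳ (cross-∉parked _ _ (prismLabel-≢ g (λ ()) (λ ()) X)
                                       (prismLabel-≢ g (λ ()) (λ ()) Y)) ⟩
      edge Eg a b        ≡⟨ edge-≡ rg a b ⟩
      prismEdge g C X Y  ≡⟨ prismEdge-embed (unionʳ-embedding f g) C X Y ⟨
      prismEdge (union f g) C (unionVertex {m} {p} (inj₂ X)) (unionVertex {m} {p} (inj₂ Y)) ∎
      where
      X = φg a
      Y = φg b
    ... | inj₁ a | inj₂ b = cross-fg (φf a) (φg b)
    ... | inj₂ a | inj₁ b = cross-gf (φg a) (φf b)

    edges : ∀ w w' → edge (unionStep C Ef Eg) w w' ≡ prismEdge (union f g) C (φ w) (φ w')
    edges w w' = begin
      edge (unpark E₁) w w'
        ≡⟨ edge-relabelAll (tagged parked) (tagged compl) E₁ w w' ⟩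
      edge E₁ w w'
        ≡⟨ edge-joinEach (nonAdjacent C) (tagged parked) (tagged compl) parked≢compl E₀ w w' ⟩
      edge E₀ w w' ∨ cross (label E₀ w) (label E₀ w')
        ≡⟨ cong₂ (λ l l' → edge E₀ w w' ∨ cross l l') (labels₀ w) (labels₀ w') ⟩
      edge E₀ w w' ∨ cross (side (splitAt Nf w)) (side (splitAt Nf w'))
        ≡⟨ edges₀ w w' ⟩
      prismEdge (union f g) C (φ w) (φ w') ∎

  size : ∀ {m} → Expr k m → ℕ
  size (vert _)        = 2
  size (union f g)     = size f + size g
  size (join _ _ _ f)  = size f
  size (relabel _ _ f) = size f

  prismExpr : ∀ {m} (f : Expr k m) → Context → Expr (3 * k) (size f)
  prismExpr (vert i)         C = vertStep i
  prismExpr (union f g)      C = unionStep C (prismExpr f C) (prismExpr g C)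
  prismExpr (join a b a≢b f) C = joinStep a b a≢b (prismExpr f (joinContext a b C))
  prismExpr (relabel a b f)  C = relabelStep a b (prismExpr f (relabelContext a b C))

  vertex↔ : ∀ {m} (f : Expr k m) → Fin (size f) ↔ (Fin m ⊎ Fin m)
  vertex↔ (vert _)            = +↔⊎
  vertex↔ (union {m} {p} f g) = unionVertex↔ m p ↔-∘ ((vertex↔ f ⊎-↔ vertex↔ g) ↔-∘ +↔⊎)
  vertex↔ (join _ _ _ f)      = vertex↔ f
  vertex↔ (relabel _ _ f)     = vertex↔ f

  prismExpr-realises : ∀ {m} (f : Expr k m) C → Realises f C (prismExpr f C) (Inverse.to (vertex↔ f))
  prismExpr-realises (vert i)         C = vert-realises i C
  prismExpr-realises (union f g)      C = union-realises (prismExpr-realises f C) (prismExpr-realises g C)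
  prismExpr-realises (join a b a≢b f) C = join-realises a b a≢b (prismExpr-realises f (joinContext a b C))
  prismExpr-realises (relabel a b f)  C = relabel-realises a b (prismExpr-realises f (relabelContext a b C))

  prismEdge-prismAdj : ∀ {n} {e : Expr k n} {G : Graph n} {σ : Fin n → Fin n} → Injective _≡_ _≡_ σ →
                       (∀ u v → edge e (σ u) (σ v) ≡ adj G u v) →
                       ∀ x y → prismEdge e noContext (Sum.map σ σ (splitAt n x)) (Sum.map σ σ (splitAt n y))
                                 ≡ prismAdj G x y
  prismEdge-prismAdj {n} σ-inj e-defines-G x y with splitAt n x | splitAt n y
  ... | inj₁ u | inj₁ v = e-defines-G u v
  ... | inj₁ u | inj₂ v = ==-injective σ-inj u v
  ... | inj₂ u | inj₁ v = ==-injective σ-inj u v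
  ... | inj₂ u | inj₂ v rewrite e-defines-G u v | ==-injective σ-inj u v = refl

  prism-cw : ∀ {n} {G : Graph n} → CWAtMost k G → CWAtMost (3 * k) (prism G)
  prism-cw {n} {G} (e , σ , e-defines-G) = CWAtMost-via {G = prism G} (prismExpr e noContext) π λ x y → begin
    edge (prismExpr e noContext) (π ⟨$⟩ʳ x) (π ⟨$⟩ʳ y)
      ≡⟨ edge-≡ (prismExpr-realises e noContext) (π ⟨$⟩ʳ x) (π ⟨$⟩ʳ y) ⟩
    prismEdge e noContext (vertex (π ⟨$⟩ʳ x)) (vertex (π ⟨$⟩ʳ y))
      ≡⟨ cong₂ (prismEdge e noContext) (Inverse.strictlyInverseˡ (vertex↔ e) _)
                                        (Inverse.strictlyInverseˡ (vertex↔ e) _) ⟩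
    prismEdge e noContext (Sum.map (σ ⟨$⟩ʳ_) (σ ⟨$⟩ʳ_) (splitAt n x))
                          (Sum.map (σ ⟨$⟩ʳ_) (σ ⟨$⟩ʳ_) (splitAt n y))
      ≡⟨ prismEdge-prismAdj (Injection.injective (↔⇒↣ σ)) e-defines-G x y ⟩
    prismAdj G x y ∎
    where
    vertex = Inverse.to (vertex↔ e)

    π : Permutation (n + n) (size e)
    π = ↔-sym (vertex↔ e) ↔-∘ ((σ ⊎-↔ σ) ↔-∘ +↔⊎)

open Prism using (prism-cw)

proposition1 : ∀ {n} (G : Graph n) (cw : ℕ) → CliqueWidth G cw → CWAtMost (4 * cw) (prism G)
proposition1 G cw (cw-G , _) = CWAtMost-≤ {G = prism G} (*-monoˡ-≤ cw (n≤1+n 3)) (prism-cw {k = cw} cw-G)
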